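{- Let $n\ge 2$ and let $T$ be a tree on $n$ vertices. Then $d_t(T,i)\le\binom{n-1}{i-1}$ for every $1\le i\le n$. Moreover, $d_t(T,i)=\binom{n-1}{i-1}$ holds for all $2\le i\le n$ if and only if $T$ is the star $S_n=K_{1,n-1}$.
   Context: A set $D\subseteq V(G)$ of a finite simple graph $G$ is a total dominating set if every vertex of $G$ is adjacent to some vertex of $D$. $d_t(G,i)$ denotes the number of total dominating sets of $G$ of size $i$. -}

module Defs where

open import Data.Empty using (⊥)
open import Data.Bool using (Bool; true; false; _∧_)
open import Data.Nat using (ℕ; zero; suc; _≤_)
open import Data.Fin using (Fin; zero; suc)
open import Data.Fin.Subset using (Subset; ∣_∣; _∈_)
open import Data.Fin.Subset.Properties using (_∈?_)
open import Data.Fin.Properties using (all?; any?)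
open import Data.Vec using (Vec; []; _∷_)
open import Data.List using (List; []; _∷_; _++_; map; filter; length)
open import Data.List.Relation.Unary.Unique.Propositional using (Unique)
open import Data.List.Relation.Unary.Linked using (Linked)
open import Data.Product using (Σ; ∃; _×_; _,_)
open import Relation.Binary.PropositionalEquality using (_≡_; _≢_)
open import Relation.Nullary using (Dec; ¬_)
open import Relation.Nullary.Decidable using (_×-dec_)
open import Data.Bool.Properties using () renaming (_≟_ to _≟ᵇ_)
import Data.Nat as ℕ
open import Data.Fin.Permutation using (Permutation′; _⟨$⟩ʳ_)

record Graph (n : ℕ) : Set where
  field
    adj   : Fin n → Fin n → Bool
    sym   : ∀ u v → adj u v ≡ adj v u
    irrefl : ∀ v → adj v v ≡ false

open Graph public

Adj : ∀ {n} → Graph n → Fin n → Fin n → Set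
Adj G u v = adj G u v ≡ true

data Walk {n} (G : Graph n) : Fin n → Fin n → Set where
  here : ∀ {u} → Walk G u u
  step : ∀ {u w v} → Adj G u w → Walk G w v → Walk G u v

Connected : ∀ {n} → Graph n → Set
Connected G = ∀ u v → Walk G u v

lastOr : ∀ {n} → Fin n → List (Fin n) → Fin n
lastOr x []       = x
lastOr x (y ∷ ys) = lastOr y ys

HasCycle : ∀ {n} → Graph n → Set
HasCycle {n} G =
  Σ (Fin n) λ x → Σ (Fin n) λ y → Σ (Fin n) λ z → Σ (List (Fin n)) λ rest →
    Unique (x ∷ y ∷ z ∷ rest) × Linked (Adj G) (x ∷ y ∷ z ∷ rest)
      × Adj G (lastOr z rest) x

IsTree : ∀ {n} → Graph n → Set
IsTree G = Connected G × ¬ HasCycle G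

IsTotalDominating : ∀ {n} → Graph n → Subset n → Set
IsTotalDominating G D = ∀ v → ∃ λ u → u ∈ D × Adj G v u

isTotalDominating? : ∀ {n} (G : Graph n) (D : Subset n) → Dec (IsTotalDominating G D)
isTotalDominating? G D = all? λ v → any? λ u → (u ∈? D) ×-dec (adj G v u ≟ᵇ true)

allSubsets : ∀ n → List (Subset n)
allSubsets zero    = [] ∷ []
allSubsets (suc n) = map (false ∷_) (allSubsets n) ++ map (true ∷_) (allSubsets n)

dt : ∀ {n} → Graph n → ℕ → ℕ
dt {n} G i = length (filter (λ D → (∣ D ∣ ℕ.≟ i) ×-dec isTotalDominating? G D) (allSubsets n))

starAdj : ∀ {m} → Fin (suc m) → Fin (suc m) → Bool
starAdj zero    zero    = false
starAdj zero    (suc _) = true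
starAdj (suc _) zero    = true
starAdj (suc _) (suc _) = false

IsStar : ∀ {n} → Graph n → Set
IsStar {zero}  G = ⊥   -- the empty graph is not a star (irrelevant since n ≥ 2)
IsStar {suc m} G = Σ (Permutation′ (suc m)) λ π →
  ∀ u v → adj G u v ≡ starAdj (π ⟨$⟩ʳ u) (π ⟨$⟩ʳ v)

module Submission where

-- A tree T with n ≥ 2 vertices has a leaf ℓ; its only neighbour s must lie in every total
-- dominating set, since ℓ has to be dominated.  So d_t(T,i) is at most the number of
-- i-subsets containing s, which is C(n-1,i-1).  If equality holds at i = 2, every pair {s,x}
-- is total dominating, so every x ≠ s is adjacent to s; an edge avoiding s would close a
-- triangle with s, so T is the star centred at s.  Conversely, in a star the total dominating
-- sets of size at least 2 are exactly the sets containing the centre.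

open import Defs hiding (sym)
open import Data.Bool using (true; false)
open import Data.Bool.Properties using (¬-not) renaming (_≟_ to _≟ᵇ_)
open import Data.Empty using (⊥; ⊥-elim)
open import Data.Fin as F using (Fin; zero; suc)
open import Data.Fin.Properties using (pigeonhole; any?; 0≢1+n)
open import Data.Fin.Permutation using (Permutation′; _⟨$⟩ʳ_; _⟨$⟩ˡ_; inverseˡ; inverseʳ; transpose)
open import Data.Fin.Subset using (Subset; ∣_∣; _∈_; ⁅_⁆; _∪_) renaming (_⊆_ to _⊆ₛ_)
open import Data.Fin.Subset.Properties using (_∈?_; ∣⁅x⁆∣≡1; x∈⁅x⁆; x∈⁅y⁆⇒x≡y; p⊆q⇒∣p∣≤∣q∣; ∪-identityˡ; ∪-identityʳ; x∈p∪q⁺; x∈p∪q⁻)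
open import Data.List using (List; []; _∷_; _++_; map; filter; length; lookup)
open import Data.List.Properties using (filter-++; filter-≐; length-++)
open import Data.List.Membership.Propositional using () renaming (_∈_ to _∈ₗ_)
open import Data.List.Membership.Propositional.Properties using (∈-map⁺; ∈-++⁺ˡ; ∈-++⁺ʳ; ∈-lookup)
open import Data.List.Relation.Unary.All as All using (All; []; _∷_)
open import Data.List.Relation.Unary.All.Properties using (¬Any⇒All¬)
open import Data.List.Relation.Unary.AllPairs using ([]; _∷_)
open import Data.List.Relation.Unary.Linked using (Linked; []; [-]; _∷_)
open import Data.List.Relation.Unary.Unique.Propositional using (Unique)
open import Data.List.Relation.Unary.Any using (here; there)
import Data.List.Membership.DecPropositional as DecMembership
open import Data.Nat as ℕ using (ℕ; zero; suc; _+_; _∸_; _≤_; _<_; z≤n; s≤s)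
open import Data.Nat.Properties using (≤-refl; ≤-trans; ≤-reflexive; ≰⇒>; <⇒≱; +-suc; m<m+n; m≤n⇒m≤1+n; m<n⇒m<1+n; <⇒≢; +-comm; suc-injective)
open import Data.Nat.Combinatorics using (_C_; nCk+nC[k+1]≡[n+1]C[k+1])
open import Data.Sum using (inj₁; inj₂)
open import Data.Product using (∃; ∃₂; _×_; _,_; proj₁; proj₂)
open import Data.Vec using ([]; _∷_; here; there)
open import Function using (_∘_)
open import Function.Bundles using (_⇔_; mk⇔)
open import Level using (0ℓ)
open import Relation.Binary using (Rel)
open import Relation.Binary.PropositionalEquality
open import Relation.Nullary using (yes; no; ¬_; contradiction)
open import Relation.Nullary.Decidable using (_×-dec_; ¬?; decidable-stable)
open import Relation.Unary using (Pred; Decidable; _⊆_; _≐_; _∩_)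
open import Relation.Unary.Properties using (_∩?_)

count : ∀ {a p} {A : Set a} {P : Pred A p} → Decidable P → List A → ℕ
count P? xs = length (filter P? xs)

module _ {a p q} {A : Set a} {P : Pred A p} {Q : Pred A q}
         (P? : Decidable P) (Q? : Decidable Q) where

  count-cong : P ≐ Q → ∀ xs → count P? xs ≡ count Q? xs
  count-cong P≐Q xs = cong length (filter-≐ P? Q? P≐Q xs)

  module _ (P⊆Q : P ⊆ Q) where

    count-mono : ∀ xs → count P? xs ≤ count Q? xs
    count-mono []       = z≤n
    count-mono (x ∷ xs) with P? x | Q? x
    ... | yes _  | yes _  = s≤s (count-mono xs)
    ... | yes px | no ¬qx = contradiction (P⊆Q px) ¬qx
    ... | no _   | yes _  = m≤n⇒m≤1+n (count-mono xs)
    ... | no _   | no _   = count-mono xs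

    count-< : ∀ {x xs} → x ∈ₗ xs → Q x → ¬ P x → count P? xs < count Q? xs
    count-< {xs = y ∷ xs} (here refl) qy ¬py with P? y | Q? y
    ... | yes py | _      = contradiction py ¬py
    ... | no _   | yes _  = s≤s (count-mono xs)
    ... | no _   | no ¬qy = contradiction qy ¬qy
    count-< {xs = y ∷ xs} (there x∈xs) qx ¬px with P? y | Q? y
    ... | yes _  | yes _  = s≤s (count-< x∈xs qx ¬px)
    ... | yes py | no ¬qy = contradiction (P⊆Q py) ¬qy
    ... | no _   | yes _  = m<n⇒m<1+n (count-< x∈xs qx ¬px)
    ... | no _   | no _   = count-< x∈xs qx ¬px

    count-≡⇒⊇ : ∀ {x xs} → count P? xs ≡ count Q? xs → x ∈ₗ xs → Q x → P x
    count-≡⇒⊇ {x} eq x∈xs qx with P? x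
    ... | yes px  = px
    ... | no ¬px = contradiction eq (<⇒≢ (count-< x∈xs qx ¬px))

module _ {a p} {A : Set a} {P : Pred A p} (P? : Decidable P) where

  count-++ : ∀ xs ys → count P? (xs ++ ys) ≡ count P? xs + count P? ys
  count-++ xs ys = trans (cong length (filter-++ P? xs ys)) (length-++ (filter P? xs))

  count-map : ∀ {b} {B : Set b} (f : B → A) xs → count P? (map f xs) ≡ count (P? ∘ f) xs
  count-map f []       = refl
  count-map f (x ∷ xs) with P? (f x)
  ... | yes _ = cong suc (count-map f xs)
  ... | no _  = count-map f xs

  count-none : (∀ x → ¬ P x) → ∀ xs → count P? xs ≡ 0
  count-none ¬P []       = refl
  count-none ¬P (x ∷ xs) with P? x
  ... | yes px = contradiction px (¬P x)
  ... | no _   = count-none ¬P xs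

∣⁅x⁆∪⁅y⁆∣≡2 : ∀ {n} {x y : Fin n} → x ≢ y → ∣ ⁅ x ⁆ ∪ ⁅ y ⁆ ∣ ≡ 2
∣⁅x⁆∪⁅y⁆∣≡2 {x = zero}  {zero}  x≢y = contradiction refl x≢y
∣⁅x⁆∪⁅y⁆∣≡2 {x = zero}  {suc y} _   = cong suc (trans (cong ∣_∣ (∪-identityˡ ⁅ y ⁆)) (∣⁅x⁆∣≡1 y))
∣⁅x⁆∪⁅y⁆∣≡2 {x = suc x} {zero}  _   = cong suc (trans (cong ∣_∣ (∪-identityʳ ⁅ x ⁆)) (∣⁅x⁆∣≡1 x))
∣⁅x⁆∪⁅y⁆∣≡2 {x = suc x} {suc y} x≢y = ∣⁅x⁆∪⁅y⁆∣≡2 (x≢y ∘ cong suc)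

2≤∣∣⇒∃∈≢ : ∀ {n} {D : Subset n} (c : Fin n) → 2 ≤ ∣ D ∣ → ∃ λ u → u ∈ D × u ≢ c
2≤∣∣⇒∃∈≢ {D = D} c 2≤∣D∣ with any? (λ u → (u ∈? D) ×-dec ¬? (u F.≟ c))
... | yes ∃u = ∃u
... | no ∄u = contradiction (≤-trans (p⊆q⇒∣p∣≤∣q∣ D⊆⁅c⁆) (≤-reflexive (∣⁅x⁆∣≡1 c))) (<⇒≱ 2≤∣D∣)
  where
  D⊆⁅c⁆ : D ⊆ₛ ⁅ c ⁆
  D⊆⁅c⁆ {x} x∈D = subst (_∈ ⁅ c ⁆) (sym x≡c) (x∈⁅x⁆ c)
    where x≡c = decidable-stable (x F.≟ c) (λ x≢c → ∄u (x , x∈D , x≢c))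

∈⇒1≤∣∣ : ∀ {n} {x : Fin n} {D : Subset n} → x ∈ D → 1 ≤ ∣ D ∣
∈⇒1≤∣∣ {x = x} {D} x∈D = subst (_≤ ∣ D ∣) (∣⁅x⁆∣≡1 x)
  (p⊆q⇒∣p∣≤∣q∣ (λ y∈⁅x⁆ → subst (_∈ D) (sym (x∈⁅y⁆⇒x≡y x y∈⁅x⁆)) x∈D))

∈-allSubsets : ∀ {n} (D : Subset n) → D ∈ₗ allSubsets n
∈-allSubsets []                = here refl
∈-allSubsets {suc n} (false ∷ D) = ∈-++⁺ˡ (∈-map⁺ (false ∷_) (∈-allSubsets D))
∈-allSubsets {suc n} (true ∷ D)  =
  ∈-++⁺ʳ (map (false ∷_) (allSubsets n)) (∈-map⁺ (true ∷_) (∈-allSubsets D))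

count-allSubsets : ∀ {n p} {P : Pred (Subset (suc n)) p} (P? : Decidable P) →
  count P? (allSubsets (suc n)) ≡
  count (P? ∘ (false ∷_)) (allSubsets n) + count (P? ∘ (true ∷_)) (allSubsets n)
count-allSubsets {n} P? = begin
  count P? (map (false ∷_) (allSubsets n) ++ map (true ∷_) (allSubsets n))
    ≡⟨ count-++ P? (map (false ∷_) (allSubsets n)) _ ⟩
  count P? (map (false ∷_) (allSubsets n)) + count P? (map (true ∷_) (allSubsets n))
    ≡⟨ cong₂ _+_ (count-map P? (false ∷_) (allSubsets n)) (count-map P? (true ∷_) (allSubsets n)) ⟩
  count (P? ∘ (false ∷_)) (allSubsets n) + count (P? ∘ (true ∷_)) (allSubsets n) ∎
  where open ≡-Reasoning

Sized : ∀ {n} → ℕ → Pred (Subset n) 0ℓ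
Sized i D = ∣ D ∣ ≡ i

sized? : ∀ {n} i → Decidable (Sized {n} i)
sized? i D = ∣ D ∣ ℕ.≟ i

sized-∋? : ∀ {n} i (c : Fin n) → Decidable (Sized i ∩ (c ∈_))
sized-∋? i c = sized? i ∩? (c ∈?_)

pascal : ∀ n k → n C suc k + n C k ≡ suc n C suc k
pascal n k = trans (+-comm (n C suc k) (n C k)) (nCk+nC[k+1]≡[n+1]C[k+1] n k)

count-sized : ∀ n i → count (sized? i) (allSubsets n) ≡ n C i
count-sized zero    zero    = refl
count-sized zero    (suc i) = refl
count-sized (suc n) zero    = trans (count-allSubsets {n} (sized? 0))
  (cong₂ _+_ (count-sized n 0) (count-none (sized? 0 ∘ (true ∷_)) (λ _ ()) (allSubsets n)))
count-sized (suc n) (suc i) = begin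
  count (sized? (suc i)) (allSubsets (suc n))
    ≡⟨ count-allSubsets {n} (sized? (suc i)) ⟩
  count (sized? (suc i)) (allSubsets n) + count (sized? (suc i) ∘ (true ∷_)) (allSubsets n)
    ≡⟨ cong (count (sized? (suc i)) (allSubsets n) +_)
            (count-cong (sized? (suc i) ∘ (true ∷_)) (sized? i) (suc-injective , cong suc) (allSubsets n)) ⟩
  count (sized? (suc i)) (allSubsets n) + count (sized? i) (allSubsets n)
    ≡⟨ cong₂ _+_ (count-sized n (suc i)) (count-sized n i) ⟩
  n C suc i + n C i
    ≡⟨ pascal n i ⟩
  suc n C suc i ∎
  where open ≡-Reasoning

count-sized-∋ : ∀ m (c : Fin (suc m)) j → count (sized-∋? (suc j) c) (allSubsets (suc m)) ≡ m C j
count-sized-∋ m zero j = begin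
  count (sized-∋? (suc j) zero) (allSubsets (suc m))
    ≡⟨ count-allSubsets {m} (sized-∋? (suc j) zero) ⟩
  count (sized-∋? (suc j) zero ∘ (false ∷_)) Ds + count (sized-∋? (suc j) zero ∘ (true ∷_)) Ds
    ≡⟨ cong₂ _+_ (count-none (sized-∋? (suc j) zero ∘ (false ∷_)) (λ { _ (_ , ()) }) Ds)
                 (count-cong (sized-∋? (suc j) zero ∘ (true ∷_)) (sized? j) ∋zero≐ Ds) ⟩
  count (sized? j) Ds
    ≡⟨ count-sized m j ⟩
  m C j ∎
  where
  open ≡-Reasoning
  Ds = allSubsets m
  ∋zero≐ : (Sized (suc j) ∩ (zero ∈_)) ∘ (true ∷_) ≐ Sized j
  ∋zero≐ = (λ (e , _) → suc-injective e) , (λ e → cong suc e , here)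
count-sized-∋ (suc m) (suc c) j = begin
  count (sized-∋? (suc j) (suc c)) (allSubsets (suc (suc m)))
    ≡⟨ count-allSubsets {suc m} (sized-∋? (suc j) (suc c)) ⟩
  count (sized-∋? (suc j) (suc c) ∘ (false ∷_)) Ds + count (sized-∋? (suc j) (suc c) ∘ (true ∷_)) Ds
    ≡⟨ cong₂ _+_ (count-cong (sized-∋? (suc j) (suc c) ∘ (false ∷_)) (sized-∋? (suc j) c) false∷≐ Ds)
                 (count-cong (sized-∋? (suc j) (suc c) ∘ (true ∷_)) (sized-∋? j c) true∷≐ Ds) ⟩
  count (sized-∋? (suc j) c) Ds + count (sized-∋? j c) Ds
    ≡⟨ cong (_+ count (sized-∋? j c) Ds) (count-sized-∋ m c j) ⟩
  m C j + count (sized-∋? j c) Ds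
    ≡⟨ pascal-∋ j ⟩
  suc m C j ∎
  where
  open ≡-Reasoning
  Ds = allSubsets (suc m)
  false∷≐ : (Sized (suc j) ∩ (suc c ∈_)) ∘ (false ∷_) ≐ Sized (suc j) ∩ (c ∈_)
  false∷≐ = (λ { (e , there c∈D) → e , c∈D }) , (λ (e , c∈D) → e , there c∈D)
  true∷≐ : (Sized (suc j) ∩ (suc c ∈_)) ∘ (true ∷_) ≐ Sized j ∩ (c ∈_)
  true∷≐ = (λ { (e , there c∈D) → suc-injective e , c∈D }) , (λ (e , c∈D) → cong suc e , there c∈D)
  pascal-∋ : ∀ i → m C i + count (sized-∋? i c) Ds ≡ suc m C i
  pascal-∋ zero    = cong (m C 0 +_) (count-none (sized-∋? 0 c)
    (λ _ (e , c∈D) → contradiction (subst (1 ≤_) e (∈⇒1≤∣∣ c∈D)) λ ()) Ds)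
  pascal-∋ (suc i) = trans (cong (m C suc i +_) (count-sized-∋ m c i)) (pascal m i)

module _ {a} {A : Set a} where

  takeThrough : ∀ {z : A} xs → z ∈ₗ xs → List A
  takeThrough (x ∷ xs) (here _)   = x ∷ []
  takeThrough (x ∷ xs) (there z∈) = x ∷ takeThrough xs z∈

  module _ {z : A} where

    takeThrough-All : ∀ {p} {P : Pred A p} {xs} (z∈ : z ∈ₗ xs) → All P xs → All P (takeThrough xs z∈)
    takeThrough-All (here _)   (px ∷ _)   = px ∷ []
    takeThrough-All (there z∈) (px ∷ pxs) = px ∷ takeThrough-All z∈ pxs

    takeThrough-Unique : ∀ {xs} (z∈ : z ∈ₗ xs) → Unique xs → Unique (takeThrough xs z∈)
    takeThrough-Unique (here _)   (_ ∷ _)     = [] ∷ []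
    takeThrough-Unique (there z∈) (x∉ ∷ uxs) = takeThrough-All z∈ x∉ ∷ takeThrough-Unique z∈ uxs

    takeThrough-Linked : ∀ {r} {R : Rel A r} {xs} (z∈ : z ∈ₗ xs) →
                         Linked R xs → Linked R (takeThrough xs z∈)
    takeThrough-Linked (here _)            _          = [-]
    takeThrough-Linked (there (here _))    (r ∷ _)    = r ∷ [-]
    takeThrough-Linked (there (there z∈)) (r ∷ rxs) = r ∷ takeThrough-Linked (there z∈) rxs

lastOr-takeThrough : ∀ {n} {z : Fin n} {xs} (z∈ : z ∈ₗ xs) y → lastOr y (takeThrough xs z∈) ≡ z
lastOr-takeThrough (here z≡x)          y = sym z≡x
lastOr-takeThrough {xs = x ∷ _} (there z∈) y = lastOr-takeThrough z∈ x

Unique⇒length≤ : ∀ {n} {xs : List (Fin n)} → Unique xs → length xs ≤ n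
Unique⇒length≤ {n} {xs} uxs with length xs ℕ.≤? n
... | yes ≤n = ≤n
... | no ≰n with i , j , i<j , eq ← pigeonhole (≰⇒> ≰n) (lookup xs) =
  contradiction eq (lookup-injective uxs i<j)
  where
  lookup-injective : ∀ {xs : List (Fin n)} → Unique xs → ∀ {i j} → i F.< j → lookup xs i ≢ lookup xs j
  lookup-injective {x ∷ xs} (x∉ ∷ _)   {zero}  {suc j} _         = All.lookup x∉ (∈-lookup j)
  lookup-injective {x ∷ xs} (_ ∷ uxs) {suc i} {suc j} (s≤s i<j) = lookup-injective uxs i<j

module _ {n} (G : Graph n) where

  Adj⇒≢ : ∀ {u v} → Adj G u v → u ≢ v
  Adj⇒≢ {u} uv refl with trans (sym uv) (irrefl G u)
  ... | ()

  Adj-sym : ∀ {u v} → Adj G u v → Adj G v u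
  Adj-sym {u} {v} uv = trans (Graph.sym G v u) uv

  Walk⇒Adj : ∀ {u v} → Walk G u v → u ≢ v → ∃ (Adj G u)
  Walk⇒Adj here         u≢u = contradiction refl u≢u
  Walk⇒Adj (step uw _) _   = _ , uw

  triangle⇒cycle : ∀ {u v w} → Adj G u v → Adj G v w → Adj G w u → HasCycle G
  triangle⇒cycle {u} {v} {w} uv vw wu =
    u , v , w , [] , ((Adj⇒≢ uv ∷ ≢-sym (Adj⇒≢ wu) ∷ []) ∷ (Adj⇒≢ vw ∷ []) ∷ [] ∷ [])
      , (uv ∷ vw ∷ [-]) , wu

  IsLeaf : Fin n → Fin n → Set
  IsLeaf ℓ s = Adj G ℓ s × (∀ {v} → Adj G ℓ v → v ≡ s)

  module _ (acyclic : ¬ HasCycle G) where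
    open DecMembership (F._≟_ {n}) using () renaming (_∈?_ to _∈ₗ?_)

    closeCycle : ∀ {x w z ys} → z ∈ₗ ys → Unique (x ∷ w ∷ ys) → Linked (Adj G) (x ∷ w ∷ ys) →
                 Adj G z x → ⊥
    closeCycle {x} {w} {z} (here refl) u l zx =
      acyclic (x , w , z , [] , takeThrough-Unique z∈ u , takeThrough-Linked z∈ l , zx)
      where z∈ = there (there (here refl))
    closeCycle {x} {w} {z} {y ∷ ys} (there z∈ys) u l zx =
      acyclic (x , w , y , takeThrough ys z∈ys , takeThrough-Unique z∈ u , takeThrough-Linked z∈ l ,
               subst (λ v → Adj G v x) (sym (lastOr-takeThrough z∈ys y)) zx)
      where z∈ = there (there (there z∈ys))

    pathEnd-isLeaf : ∀ {x w ys} → Unique (x ∷ w ∷ ys) → Linked (Adj G) (x ∷ w ∷ ys) →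
                     (∀ {v} → Adj G x v → v ∈ₗ x ∷ w ∷ ys) → IsLeaf x w
    pathEnd-isLeaf {x} {w} {ys} u l@(xw ∷ _) onPath = xw , λ xv → onPath⇒≡w (onPath xv) xv
      where
      onPath⇒≡w : ∀ {v} → v ∈ₗ x ∷ w ∷ ys → Adj G x v → v ≡ w
      onPath⇒≡w (here refl)          xx = contradiction refl (Adj⇒≢ xx)
      onPath⇒≡w (there (here v≡w))   _  = v≡w
      onPath⇒≡w (there (there v∈ys)) xv = ⊥-elim (closeCycle v∈ys u l (Adj-sym xv))

    -- The path x ∷ w ∷ ys is grown at x; the fuel k outlasts it since a simple path has ≤ n vertices.
    extendPath : ∀ k {x w ys} → n < k + length (x ∷ w ∷ ys) →
                 Unique (x ∷ w ∷ ys) → Linked (Adj G) (x ∷ w ∷ ys) → ∃₂ IsLeaf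
    extendPath zero    n<k+len u l = contradiction (Unique⇒length≤ u) (<⇒≱ n<k+len)
    extendPath (suc k) {x} {w} {ys} n<k+len u l
      with any? (λ v → (adj G x v ≟ᵇ true) ×-dec ¬? (v ∈ₗ? x ∷ w ∷ ys))
    ... | yes (v , xv , v∉) =
      extendPath k (subst (n <_) (sym (+-suc k _)) n<k+len) (¬Any⇒All¬ _ v∉ ∷ u) (Adj-sym xv ∷ l)
    ... | no ∄ = x , w , pathEnd-isLeaf u l onPath
      where
      onPath : ∀ {v} → Adj G x v → v ∈ₗ x ∷ w ∷ ys
      onPath {v} xv = decidable-stable (v ∈ₗ? x ∷ w ∷ ys) (λ v∉ → ∄ (v , xv , v∉))

    Adj⇒∃leaf : ∀ {u v} → Adj G u v → ∃₂ IsLeaf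
    Adj⇒∃leaf uv =
      extendPath n (m<m+n n (s≤s z≤n)) ((≢-sym (Adj⇒≢ uv) ∷ []) ∷ [] ∷ []) (Adj-sym uv ∷ [-])

tree⇒∃leaf : ∀ {m} (T : Graph (suc (suc m))) → IsTree T → ∃₂ (IsLeaf T)
tree⇒∃leaf T (connected , acyclic) with _ , zv ← Walk⇒Adj T (connected zero (suc zero)) (λ ()) =
  Adj⇒∃leaf T acyclic zv

module _ {n} (G : Graph n) where

  leaf⇒support∈ : ∀ {ℓ s D} → IsLeaf G ℓ s → IsTotalDominating G D → s ∈ D
  leaf⇒support∈ {D = D} (_ , only-s) td with u , u∈D , ℓu ← td _ = subst (_∈ D) (only-s ℓu) u∈D

  dt≤count-∋ : ∀ {ℓ s} → IsLeaf G ℓ s → ∀ i → dt G i ≤ count (sized-∋? i s) (allSubsets n)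
  dt≤count-∋ leaf i = count-mono (sized? i ∩? isTotalDominating? G) (sized-∋? i _)
    (λ (∣D∣≡i , td) → ∣D∣≡i , leaf⇒support∈ leaf td) (allSubsets n)

  IsStarCentre : Fin n → Set
  IsStarCentre c = (∀ {u} → u ≢ c → Adj G u c) × (∀ {u v} → u ≢ c → v ≢ c → ¬ Adj G u v)

  module _ {c} (centre : IsStarCentre c) where

    centre⇒leaf : ∀ {u} → u ≢ c → IsLeaf G u c
    centre⇒leaf u≢c = proj₁ centre u≢c ,
      λ {v} uv → decidable-stable (v F.≟ c) (λ v≢c → proj₂ centre u≢c v≢c uv)

    centre∈totalDominating : ∀ {D} → IsTotalDominating G D → c ∈ D
    centre∈totalDominating td with _ , _ , cu ← td c =
      leaf⇒support∈ (centre⇒leaf (≢-sym (Adj⇒≢ G cu))) td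

    centre∈⇒totalDominating : ∀ {D} → 2 ≤ ∣ D ∣ → c ∈ D → IsTotalDominating G D
    centre∈⇒totalDominating 2≤∣D∣ c∈D v with v F.≟ c
    ... | no v≢c   = c , c∈D , proj₁ centre v≢c
    ... | yes refl with u , u∈D , u≢c ← 2≤∣∣⇒∃∈≢ c 2≤∣D∣ =
      u , u∈D , Adj-sym G (proj₁ centre u≢c)

    dt-star : ∀ k → dt G (2 + k) ≡ count (sized-∋? (2 + k) c) (allSubsets n)
    dt-star k = count-cong (sized? (2 + k) ∩? isTotalDominating? G) (sized-∋? (2 + k) c)
      ( (λ (∣D∣≡2+k , td) → ∣D∣≡2+k , centre∈totalDominating td)
      , (λ (∣D∣≡2+k , c∈D) → ∣D∣≡2+k , centre∈⇒totalDominating (2≤ ∣D∣≡2+k) c∈D))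
      (allSubsets n)
      where
      2≤ : ∀ {d} → d ≡ 2 + k → 2 ≤ d
      2≤ refl = s≤s (s≤s z≤n)

  extremal⇒centre : ∀ {ℓ s} → ¬ HasCycle G → IsLeaf G ℓ s →
                    dt G 2 ≡ count (sized-∋? 2 s) (allSubsets n) → IsStarCentre s
  extremal⇒centre {s = s} acyclic leaf dt≡ = toS , noAdj
    where
    pairs-dominate : ∀ {D} → Sized 2 D → s ∈ D → IsTotalDominating G D
    pairs-dominate ∣D∣≡2 s∈D = proj₂ (count-≡⇒⊇ (sized? 2 ∩? isTotalDominating? G) (sized-∋? 2 s)
      (λ (∣D∣≡2 , td) → ∣D∣≡2 , leaf⇒support∈ leaf td) dt≡ (∈-allSubsets _) (∣D∣≡2 , s∈D))

    toS : ∀ {x} → x ≢ s → Adj G x s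
    toS {x} x≢s
      with u , u∈ , xu ← pairs-dominate (∣⁅x⁆∪⁅y⁆∣≡2 (≢-sym x≢s)) (x∈p∪q⁺ (inj₁ (x∈⁅x⁆ s))) x
      with x∈p∪q⁻ ⁅ s ⁆ ⁅ x ⁆ u∈
    ... | inj₁ u∈⁅s⁆ = subst (Adj G x) (x∈⁅y⁆⇒x≡y s u∈⁅s⁆) xu
    ... | inj₂ u∈⁅x⁆ = contradiction (x∈⁅y⁆⇒x≡y x u∈⁅x⁆) (≢-sym (Adj⇒≢ G xu))

    noAdj : ∀ {u v} → u ≢ s → v ≢ s → ¬ Adj G u v
    noAdj u≢s v≢s uv = acyclic (triangle⇒cycle G uv (toS v≢s) (Adj-sym G (toS u≢s)))

module _ {m} (G : Graph (suc m)) (π : Permutation′ (suc m)) where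

  private
    c : Fin (suc m)
    c = π ⟨$⟩ˡ zero

  π≡0⇒≡c : ∀ {u} → π ⟨$⟩ʳ u ≡ zero → u ≡ c
  π≡0⇒≡c e = trans (sym (inverseˡ π)) (cong (π ⟨$⟩ˡ_) e)

  π≡suc⇒≢c : ∀ {u k} → π ⟨$⟩ʳ u ≡ suc k → u ≢ c
  π≡suc⇒≢c e refl = 0≢1+n (trans (sym (inverseʳ π)) e)

  ≢c⇒π≡suc : ∀ {u} → u ≢ c → ∃ λ k → π ⟨$⟩ʳ u ≡ suc k
  ≢c⇒π≡suc {u} u≢c with π ⟨$⟩ʳ u in eu
  ... | zero  = contradiction (π≡0⇒≡c eu) u≢c
  ... | suc k = k , refl

  starAdj⇒centre : (∀ u v → adj G u v ≡ starAdj (π ⟨$⟩ʳ u) (π ⟨$⟩ʳ v)) → IsStarCentre G c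
  starAdj⇒centre h = toC , noAdj
    where
    toC : ∀ {u} → u ≢ c → Adj G u c
    toC {u} u≢c with _ , eu ← ≢c⇒π≡suc u≢c = trans (h u c) (cong₂ starAdj eu (inverseʳ π))

    noAdj : ∀ {u v} → u ≢ c → v ≢ c → ¬ Adj G u v
    noAdj {u} {v} u≢c v≢c uv with _ , eu ← ≢c⇒π≡suc u≢c | _ , ev ← ≢c⇒π≡suc v≢c
      with () ← trans (sym uv) (trans (h u v) (cong₂ starAdj eu ev))

  centre⇒starAdj : IsStarCentre G c → ∀ u v → adj G u v ≡ starAdj (π ⟨$⟩ʳ u) (π ⟨$⟩ʳ v)
  centre⇒starAdj (toC , noAdj) u v with π ⟨$⟩ʳ u in eu | π ⟨$⟩ʳ v in ev
  ... | zero  | zero  = trans (cong₂ (adj G) (π≡0⇒≡c eu) (π≡0⇒≡c ev)) (irrefl G c)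
  ... | zero  | suc _ = trans (cong (λ w → adj G w v) (π≡0⇒≡c eu)) (Adj-sym G (toC (π≡suc⇒≢c ev)))
  ... | suc _ | zero  = subst (Adj G u) (sym (π≡0⇒≡c ev)) (toC (π≡suc⇒≢c eu))
  ... | suc _ | suc _ = ¬-not (noAdj (π≡suc⇒≢c eu) (π≡suc⇒≢c ev))

isStar⇒∃centre : ∀ {m} (G : Graph (suc m)) → IsStar G → ∃ (IsStarCentre G)
isStar⇒∃centre G (π , h) = _ , starAdj⇒centre G π h

-- Type-checks because (transpose c zero) ⟨$⟩ˡ zero reduces to c.
centre⇒isStar : ∀ {m} (G : Graph (suc m)) {c} → IsStarCentre G c → IsStar G
centre⇒isStar G {c} centre = transpose c zero , centre⇒starAdj G (transpose c zero) centre

theorem5 : (n : ℕ) → 2 ≤ n → (T : Graph n) → IsTree T →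
    ((i : ℕ) → 1 ≤ i → i ≤ n → dt T i ≤ (n ∸ 1) C (i ∸ 1))
    × (((i : ℕ) → 2 ≤ i → i ≤ n → dt T i ≡ (n ∸ 1) C (i ∸ 1)) ⇔ IsStar T)
theorem5 (suc (suc m)) (s≤s (s≤s z≤n)) T tree@(_ , acyclic) with _ , s , leaf ← tree⇒∃leaf T tree =
  bound , mk⇔ extremal⇒star star⇒extremal
  where
  bound : ∀ i → 1 ≤ i → i ≤ suc (suc m) → dt T i ≤ suc m C (i ∸ 1)
  bound (suc j) _ _ = ≤-trans (dt≤count-∋ T leaf (suc j)) (≤-reflexive (count-sized-∋ (suc m) s j))

  extremal⇒star : (∀ i → 2 ≤ i → i ≤ suc (suc m) → dt T i ≡ suc m C (i ∸ 1)) → IsStar T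
  extremal⇒star dt≡ = centre⇒isStar T (extremal⇒centre T acyclic leaf
    (trans (dt≡ 2 ≤-refl (s≤s (s≤s z≤n))) (sym (count-sized-∋ (suc m) s 1))))

  star⇒extremal : IsStar T → ∀ i → 2 ≤ i → i ≤ suc (suc m) → dt T i ≡ suc m C (i ∸ 1)
  star⇒extremal star (suc (suc k)) (s≤s (s≤s z≤n)) _ with c , centre ← isStar⇒∃centre T star =
    trans (dt-star T centre k) (count-sized-∋ (suc m) c (suc k))
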